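{- Let $\mathcal G=(V,E)$ be a graph in which loops are allowed. If $\mathcal G$ is a complete graph, or $\mathcal G$ is an e-empty graph in which, if some vertex has a loop, then every vertex has a loop, then $\mathcal G$ is quasi-projective (within the class of graphs with loops allowed).
   Context: Graphs are undirected: $E$ is a set of unordered pairs of (not necessarily distinct) vertices; a loop is an edge joining a vertex to itself, and loops are allowed in all graphs considered (including the targets $\mathcal T$ below). With loops allowed, a graph is complete if every pair of vertices, including each vertex with itself, forms an edge ($E=V^2$ as a relation). A graph is e-empty if there are no edges between distinct vertices (loops may be present). A homomorphism is a map of vertices sending edges to edges; an epimorphism is a surjective homomorphism. A graph $\mathcal S$ is quasi-projective if for every such graph $\mathcal T$, every homomorphism $f:\mathcal S\to\mathcal T$ and every epimorphism $j:\mathcal S\to\mathcal T$, there is an endomorphism $\phi$ of $\mathcal S$ with $j\circ\phi=f$. -}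

module Defs where

open import Data.Product using (Σ; ∃; _×_; _,_)
open import Relation.Binary.PropositionalEquality using (_≡_)

-- An undirected graph with loops allowed: a vertex set V and a symmetric
-- edge relation E (E x x means a loop at x).
record Graph : Set₁ where
  field
    V    : Set
    E    : V → V → Set
    symm : ∀ {x y} → E x y → E y x
open Graph public

IsHom : (S T : Graph) → (V S → V T) → Set
IsHom S T f = ∀ {x y} → E S x y → E T (f x) (f y)

Surjective : {A B : Set} → (A → B) → Set
Surjective {A} {B} f = ∀ (b : B) → ∃ λ (a : A) → f a ≡ b

IsEpi : (S T : Graph) → (V S → V T) → Set
IsEpi S T j = IsHom S T j × Surjective j

Complete : Graph → Set
Complete G = ∀ (x y : V G) → E G x y

EEmpty : Graph → Set
EEmpty G = ∀ {x y : V G} → E G x y → x ≡ y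

LoopsUniform : Graph → Set
LoopsUniform G = (∃ λ (x : V G) → E G x x) → ∀ (y : V G) → E G y y

QuasiProjective : Graph → Set₁
QuasiProjective S =
  ∀ (T : Graph) (f j : V S → V T) → IsHom S T f → IsEpi S T j →
    ∃ λ (φ : V S → V S) → IsHom S S φ × (∀ x → j (φ x) ≡ f x)

-- Choosing a preimage under j of each f x gives a map φ with j ∘ φ = f. On a
-- complete graph every self-map is an endomorphism; on an e-empty graph an
-- edge is a loop, and when loops are all-or-nothing a loop at x forces one
-- at φ x, so again every self-map is an endomorphism.
module Submission where

open import Defs
open import Data.Product using (_×_; _,_; proj₁; proj₂)
open import Data.Sum using (_⊎_; inj₁; inj₂)
open import Relation.Binary.PropositionalEquality using (refl)

AllMapsEndo : Graph → Set
AllMapsEndo G = ∀ (φ : V G → V G) → IsHom G G φ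

allMapsEndo⇒quasiProjective : ∀ G → AllMapsEndo G → QuasiProjective G
allMapsEndo⇒quasiProjective G endo T f j _ (_ , j-surj) =
  φ , endo φ , λ x → proj₂ (j-surj (f x))
  where
  φ : V G → V G
  φ x = proj₁ (j-surj (f x))

complete⇒allMapsEndo : ∀ G → Complete G → AllMapsEndo G
complete⇒allMapsEndo _ complete φ {x} {y} _ = complete (φ x) (φ y)

eEmpty∧loopsUniform⇒allMapsEndo : ∀ G → EEmpty G → LoopsUniform G → AllMapsEndo G
eEmpty∧loopsUniform⇒allMapsEndo _ eEmpty loopsUniform φ {x} e with eEmpty e
... | refl = loopsUniform (x , e) (φ x)

lemma4p7 : (G : Graph) → Complete G ⊎ (EEmpty G × LoopsUniform G) → QuasiProjective G
lemma4p7 G (inj₁ complete) =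
  allMapsEndo⇒quasiProjective G (complete⇒allMapsEndo G complete)
lemma4p7 G (inj₂ (eEmpty , loopsUniform)) =
  allMapsEndo⇒quasiProjective G (eEmpty∧loopsUniform⇒allMapsEndo G eEmpty loopsUniform)
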